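{- Let $n\in\mathbb{N}$, $u\in\mathcal{A}_n^*$ and $i\in\{1,\dots,n-1\}$. (1) If $e_i(u)$ is defined, then $\mathrm{std}(e_i(u))=\mathrm{std}(u)$. (2) If $f_i(u)$ is defined, then $\mathrm{std}(f_i(u))=\mathrm{std}(u)$.
   Context: $\mathcal{A}_n=\{1<\dots<n\}$. A word $u$ has an $i$-inversion if it contains a letter $i+1$ to the left of a letter $i$. Quasi-Kashiwara operators: if $u$ has an $i$-inversion, $e_i(u),f_i(u)$ are undefined; otherwise $e_i(u)$ replaces the leftmost letter $i+1$ of $u$ by $i$ (undefined if none) and $f_i(u)$ replaces the rightmost letter $i$ by $i+1$ (undefined if none). Standardization: for a word $u$ of length $k$, $\mathrm{std}(u)$ is the unique permutation word of $\{1,\dots,k\}$ obtained by replacing the letters of $u$ by $1,\dots,k$ so that smaller letters get smaller numbers and, among equal letters, occurrences further left get smaller numbers. -}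

module Defs where

open import Data.Nat using (ℕ; zero; suc; _+_; _<ᵇ_; _≡ᵇ_)
open import Data.Bool using (Bool; true; false; _∧_; _∨_; not; if_then_else_)
open import Data.Fin using (Fin; toℕ; fromℕ<)
open import Data.List using (List; []; _∷_)
open import Data.Bool.ListAction using (any)
open import Data.Maybe using (Maybe; just; nothing; map)
open import Data.Nat.Properties using (≤-trans; n≤1+n)
open import Data.Nat using (_<_; _≤_)

-- The alphabet A_n = {1 < ... < n} is represented by Fin n:
-- the element x : Fin n stands for the letter  toℕ x + 1.
Letter : ℕ → Set
Letter n = Fin n

Word : ℕ → Set
Word n = List (Letter n)

val : ∀ {n} → Letter n → ℕ
val x = suc (toℕ x)

hasLetter : ∀ {n} → ℕ → Word n → Bool
hasLetter a u = any (λ x → val x ≡ᵇ a) u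

hasInv : ∀ {n} → ℕ → Word n → Bool
hasInv i [] = false
hasInv i (x ∷ u) = ((val x ≡ᵇ suc i) ∧ hasLetter i u) ∨ hasInv i u

replaceLeftmost : ∀ {n} → ℕ → Letter n → Word n → Maybe (Word n)
replaceLeftmost a y [] = nothing
replaceLeftmost a y (x ∷ u) =
  if val x ≡ᵇ a then just (y ∷ u) else Data.Maybe.map (x ∷_) (replaceLeftmost a y u)

replaceRightmost : ∀ {n} → ℕ → Letter n → Word n → Maybe (Word n)
replaceRightmost a y [] = nothing
replaceRightmost a y (x ∷ u) with replaceRightmost a y u
... | just u' = just (x ∷ u')
... | nothing = if val x ≡ᵇ a then just (y ∷ u) else nothing

letterBelow : ∀ {n} (i : ℕ) → 1 ≤ i → i < n → Letter n
letterBelow (suc j) _ p = fromℕ< (≤-trans (n≤1+n (suc j)) p)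

module _ {n : ℕ} (i : ℕ) (1≤i : 1 ≤ i) (i<n : i < n) where

  private
    letterI+1 : Letter n
    letterI+1 = fromℕ< i<n

    letterI : Letter n
    letterI = letterBelow i 1≤i i<n

  eOp : Word n → Maybe (Word n)
  eOp u = if hasInv i u then nothing else replaceLeftmost (suc i) letterI u

  fOp : Word n → Maybe (Word n)
  fOp u = if hasInv i u then nothing else replaceRightmost i letterI+1 u

-- Standardization.  The letter at position j (0-based) of u is sent to
--   1 + #{ p | u_p < u_j }  +  #{ p < j | u_p = u_j }.
countLess : ∀ {n} → ℕ → Word n → ℕ
countLess a [] = zero
countLess a (x ∷ u) = (if val x <ᵇ a then 1 else 0) + countLess a u

countEq : ∀ {n} → ℕ → Word n → ℕ
countEq a [] = zero
countEq a (x ∷ u) = (if val x ≡ᵇ a then 1 else 0) + countEq a u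

stdAux : ∀ {n} → Word n → Word n → Word n → List ℕ
stdAux w pre [] = []
stdAux w pre (x ∷ rest) =
  suc (countLess (val x) w + countEq (val x) pre) ∷ stdAux w (x ∷ pre) rest

std : ∀ {n} → Word n → List ℕ
std u = stdAux u [] u

-- The entry of std u at a position holding the letter c is one plus the number of letters of u
-- smaller than c plus the number of letters c to its left.  In the absence of i-inversions, e_i and
-- f_i relate the words pre · i · post and pre · (i+1) · post, where pre contains no i+1 and post
-- contains no i.  The changed letter is thus the last i, resp. the first i+1, and in both words
-- its entry is the number of letters ≤ i of pre · i · post.  Letters of pre (all ≠ i+1) do not
-- see the change, and each letter i+1 of post loses one smaller letter but gains one equal
-- letter to its left.
module Submission where

open import Defs
open import Data.Bool using (Bool; true; false; T; _∧_; _∨_; if_then_else_)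
open import Data.Bool.Properties using (∨-conicalˡ; ∨-conicalʳ; ∨-zeroʳ; ∧-identityʳ)
open import Data.Fin using (fromℕ<)
open import Data.Fin.Properties using (toℕ-fromℕ<)
open import Data.List using ([]; _∷_; _++_; _ʳ++_)
open import Data.List.Relation.Unary.All as All using (All; []; _∷_)
open import Data.Maybe using (just; nothing)
open import Data.Nat using (ℕ; zero; suc; _+_; _≤_; _<_; _≡ᵇ_; _<ᵇ_; s≤s; z≤n)
open import Data.Nat.Properties using (≡ᵇ⇒≡; ≡⇒≡ᵇ; 1+n≢n; +-assoc; +-identityʳ; +-commutativeSemigroup)
open import Algebra.Properties.CommutativeSemigroup +-commutativeSemigroup using (x∙yz≈y∙xz; interchange)
open import Data.Product using (_×_; _,_; ∃-syntax)
open import Function using (_∘_; case_of_)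
open import Relation.Binary.PropositionalEquality

open ≡-Reasoning

ind : Bool → ℕ
ind b = if b then 1 else 0

≡ᵇ-true⇒≡ : ∀ {m k} → (m ≡ᵇ k) ≡ true → m ≡ k
≡ᵇ-true⇒≡ {m} {k} e = ≡ᵇ⇒≡ m k (subst T (sym e) _)

≡⇒≡ᵇ-true : ∀ {m k} → m ≡ k → (m ≡ᵇ k) ≡ true
≡⇒≡ᵇ-true {m} {k} m≡k with m ≡ᵇ k | ≡⇒≡ᵇ m k m≡k
... | true | _ = refl

≡ᵇ-false⇒≢ : ∀ {m k} → (m ≡ᵇ k) ≡ false → m ≢ k
≡ᵇ-false⇒≢ e m≡k = case trans (sym e) (≡⇒≡ᵇ-true m≡k) of λ ()

≢⇒≡ᵇ-false : ∀ {m k} → m ≢ k → (m ≡ᵇ k) ≡ false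
≢⇒≡ᵇ-false {m} {k} m≢k with m ≡ᵇ k in e
... | true  = case m≢k (≡ᵇ-true⇒≡ e) of λ ()
... | false = refl

<ᵇ-suc : ∀ m k → ind (m <ᵇ suc k) ≡ ind (m <ᵇ k) + ind (m ≡ᵇ k)
<ᵇ-suc zero    zero    = refl
<ᵇ-suc zero    (suc k) = refl
<ᵇ-suc (suc m) zero    = refl
<ᵇ-suc (suc m) (suc k) = <ᵇ-suc m k

<ᵇ-raise : ∀ m c → ind (m <ᵇ c) ≡ ind (suc m ≡ᵇ c) + ind (suc m <ᵇ c)
<ᵇ-raise zero    zero          = refl
<ᵇ-raise zero    (suc zero)    = refl
<ᵇ-raise zero    (suc (suc c)) = refl
<ᵇ-raise (suc m) zero          = refl
<ᵇ-raise (suc m) (suc c)       = <ᵇ-raise m c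

module Tally {n : ℕ} (count : Word n → ℕ) (weight : Letter n → ℕ)
  (count-[] : count [] ≡ 0) (count-∷ : ∀ x u → count (x ∷ u) ≡ weight x + count u) where

  count-++ : ∀ u v → count (u ++ v) ≡ count u + count v
  count-++ [] v = cong (_+ count v) (sym count-[])
  count-++ (x ∷ u) v = begin
    count (x ∷ u ++ v)             ≡⟨ count-∷ x (u ++ v) ⟩
    weight x + count (u ++ v)      ≡⟨ cong (weight x +_) (count-++ u v) ⟩
    weight x + (count u + count v) ≡⟨ sym (+-assoc (weight x) _ _) ⟩
    (weight x + count u) + count v ≡⟨ cong (_+ count v) (sym (count-∷ x u)) ⟩
    count (x ∷ u) + count v        ∎

  count-ʳ++ : ∀ u v → count (u ʳ++ v) ≡ count u + count v
  count-ʳ++ [] v = cong (_+ count v) (sym count-[])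
  count-ʳ++ (x ∷ u) v = begin
    count (u ʳ++ x ∷ v)            ≡⟨ count-ʳ++ u (x ∷ v) ⟩
    count u + count (x ∷ v)        ≡⟨ cong (count u +_) (count-∷ x v) ⟩
    count u + (weight x + count v) ≡⟨ x∙yz≈y∙xz (count u) (weight x) (count v) ⟩
    weight x + (count u + count v) ≡⟨ sym (+-assoc (weight x) _ _) ⟩
    (weight x + count u) + count v ≡⟨ cong (_+ count v) (sym (count-∷ x u)) ⟩
    count (x ∷ u) + count v        ∎

  count-zero : ∀ {u} → All (λ z → weight z ≡ 0) u → count u ≡ 0
  count-zero []               = count-[]
  count-zero {x ∷ u} (z ∷ zs) = trans (count-∷ x u) (cong₂ _+_ z (count-zero zs))

module CountLess {n : ℕ} (c : ℕ) =
  Tally {n} (countLess c) (λ x → ind (val x <ᵇ c)) refl (λ _ _ → refl)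
module CountEq {n : ℕ} (c : ℕ) =
  Tally {n} (countEq c) (λ x → ind (val x ≡ᵇ c)) refl (λ _ _ → refl)

countEq-absent : ∀ {n} c {u : Word n} → All (λ z → val z ≢ c) u → countEq c u ≡ 0
countEq-absent c = CountEq.count-zero c ∘ All.map (cong ind ∘ ≢⇒≡ᵇ-false)

countLess-suc : ∀ {n} k (u : Word n) → countLess (suc k) u ≡ countLess k u + countEq k u
countLess-suc k [] = refl
countLess-suc k (x ∷ u) = begin
  ind (val x <ᵇ suc k) + countLess (suc k) u
    ≡⟨ cong₂ _+_ (<ᵇ-suc (val x) k) (countLess-suc k u) ⟩
  (ind (val x <ᵇ k) + ind (val x ≡ᵇ k)) + (countLess k u + countEq k u)
    ≡⟨ interchange (ind (val x <ᵇ k)) _ _ _ ⟩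
  (ind (val x <ᵇ k) + countLess k u) + (ind (val x ≡ᵇ k) + countEq k u) ∎

-- stdAux W Q sends a letter c to suc (rank W Q c).
rank : ∀ {n} → Word n → Word n → ℕ → ℕ
rank W Q c = countLess c W + countEq c Q

rank-∷ : ∀ {n} (W Q : Word n) x c → rank W (x ∷ Q) c ≡ ind (val x ≡ᵇ c) + rank W Q c
rank-∷ W Q x c = x∙yz≈y∙xz (countLess c W) (ind (val x ≡ᵇ c)) (countEq c Q)

stdAux-++ : ∀ {n} (W Q u v : Word n) → stdAux W Q (u ++ v) ≡ stdAux W Q u ++ stdAux W (u ʳ++ Q) v
stdAux-++ W Q []      v = refl
stdAux-++ W Q (x ∷ u) v = cong (_ ∷_) (stdAux-++ W (x ∷ Q) u v)

stdAux-cong : ∀ {n} (R : ℕ → Set) (W₁ W₂ Q₁ Q₂ s : Word n) → All (R ∘ val) s →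
  (∀ c → R c → rank W₁ Q₁ c ≡ rank W₂ Q₂ c) → stdAux W₁ Q₁ s ≡ stdAux W₂ Q₂ s
stdAux-cong R W₁ W₂ Q₁ Q₂ []      []         ranks = refl
stdAux-cong R W₁ W₂ Q₁ Q₂ (x ∷ s) (Rx ∷ Rs) ranks =
  cong₂ _∷_ (cong suc (ranks (val x) Rx)) (stdAux-cong R W₁ W₂ (x ∷ Q₁) (x ∷ Q₂) s Rs ranks′)
  where
  ranks′ : ∀ c → R c → rank W₁ (x ∷ Q₁) c ≡ rank W₂ (x ∷ Q₂) c
  ranks′ c Rc = begin
    rank W₁ (x ∷ Q₁) c              ≡⟨ rank-∷ W₁ Q₁ x c ⟩
    ind (val x ≡ᵇ c) + rank W₁ Q₁ c ≡⟨ cong (ind (val x ≡ᵇ c) +_) (ranks c Rc) ⟩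
    ind (val x ≡ᵇ c) + rank W₂ Q₂ c ≡⟨ sym (rank-∷ W₂ Q₂ x c) ⟩
    rank W₂ (x ∷ Q₂) c              ∎

module RaiseLetter {n : ℕ} (i : ℕ) (pre post : Word n) (x y : Letter n)
  (x≡i : val x ≡ i) (y≡1+i : val y ≡ suc i) where

  W₁ W₂ R : Word n
  W₁ = pre ++ x ∷ post
  W₂ = pre ++ y ∷ post
  R  = pre ʳ++ []

  countLess-split : ∀ z c → countLess c (pre ++ z ∷ post) ≡ ind (val z <ᵇ c) + countLess c (pre ++ post)
  countLess-split z c = begin
    countLess c (pre ++ z ∷ post)                          ≡⟨ CountLess.count-++ c pre (z ∷ post) ⟩
    countLess c pre + (ind (val z <ᵇ c) + countLess c post) ≡⟨ x∙yz≈y∙xz (countLess c pre) (ind (val z <ᵇ c)) _ ⟩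
    ind (val z <ᵇ c) + (countLess c pre + countLess c post) ≡⟨ cong (ind (val z <ᵇ c) +_) (sym (CountLess.count-++ c pre post)) ⟩
    ind (val z <ᵇ c) + countLess c (pre ++ post)           ∎

  countLess-raise : ∀ c → countLess c W₁ ≡ ind (val y ≡ᵇ c) + countLess c W₂
  countLess-raise c = begin
    countLess c W₁                                             ≡⟨ countLess-split x c ⟩
    ind (val x <ᵇ c) + countLess c V                           ≡⟨ cong (_+ countLess c V) x<c ⟩
    (ind (val y ≡ᵇ c) + ind (val y <ᵇ c)) + countLess c V      ≡⟨ +-assoc (ind (val y ≡ᵇ c)) _ _ ⟩
    ind (val y ≡ᵇ c) + (ind (val y <ᵇ c) + countLess c V)      ≡⟨ cong (ind (val y ≡ᵇ c) +_) (sym (countLess-split y c)) ⟩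
    ind (val y ≡ᵇ c) + countLess c W₂                          ∎
    where
    V = pre ++ post
    x<c : ind (val x <ᵇ c) ≡ ind (val y ≡ᵇ c) + ind (val y <ᵇ c)
    x<c rewrite x≡i | y≡1+i = <ᵇ-raise i c

  rank-raise : ∀ Q c → rank W₁ Q c ≡ ind (val y ≡ᵇ c) + rank W₂ Q c
  rank-raise Q c = trans (cong (_+ countEq c Q) (countLess-raise c)) (+-assoc (ind (val y ≡ᵇ c)) _ _)

  std-raise : All (λ z → val z ≢ suc i) pre → All (λ z → val z ≢ i) post → std W₁ ≡ std W₂
  std-raise pre-no-1+i post-no-i = begin
    std W₁
      ≡⟨ stdAux-++ W₁ [] pre (x ∷ post) ⟩
    stdAux W₁ [] pre ++ suc (rank W₁ R (val x)) ∷ stdAux W₁ (x ∷ R) post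
      ≡⟨ cong₂ _++_ prefix (cong₂ _∷_ (cong suc middle) suffix) ⟩
    stdAux W₂ [] pre ++ suc (rank W₂ R (val y)) ∷ stdAux W₂ (y ∷ R) post
      ≡⟨ sym (stdAux-++ W₂ [] pre (y ∷ post)) ⟩
    std W₂ ∎
    where
    y≢i : val y ≢ i
    y≢i y≡i = 1+n≢n (trans (sym y≡1+i) y≡i)

    prefix : stdAux W₁ [] pre ≡ stdAux W₂ [] pre
    prefix = stdAux-cong (_≢ suc i) W₁ W₂ [] [] pre pre-no-1+i λ c c≢1+i →
      trans (rank-raise [] c) (cong (λ b → ind b + rank W₂ [] c)
        (≢⇒≡ᵇ-false λ y≡c → c≢1+i (trans (sym y≡c) y≡1+i)))

    countEq-W₂ : countEq i W₂ ≡ countEq i pre + 0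
    countEq-W₂ = begin
      countEq i W₂                                          ≡⟨ CountEq.count-++ i pre (y ∷ post) ⟩
      countEq i pre + (ind (val y ≡ᵇ i) + countEq i post) ≡⟨ cong₂ (λ b k → countEq i pre + (ind b + k))
                                                                 (≢⇒≡ᵇ-false y≢i) (countEq-absent i post-no-i) ⟩
      countEq i pre + 0                                     ∎

    countEq-1+i-R : countEq (suc i) R ≡ 0
    countEq-1+i-R = trans (CountEq.count-ʳ++ (suc i) pre []) (cong (_+ 0) (countEq-absent (suc i) pre-no-1+i))

    middle : rank W₁ R (val x) ≡ rank W₂ R (val y)
    middle = begin
      rank W₁ R (val x)                        ≡⟨ rank-raise R (val x) ⟩
      ind (val y ≡ᵇ val x) + rank W₂ R (val x) ≡⟨ cong (λ b → ind b + rank W₂ R (val x))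
                                                    (≢⇒≡ᵇ-false λ y≡x → y≢i (trans y≡x x≡i)) ⟩
      rank W₂ R (val x)                        ≡⟨ cong (rank W₂ R) x≡i ⟩
      countLess i W₂ + countEq i R             ≡⟨ cong (countLess i W₂ +_)
                                                    (trans (CountEq.count-ʳ++ i pre []) (sym countEq-W₂)) ⟩
      countLess i W₂ + countEq i W₂            ≡⟨ sym (countLess-suc i W₂) ⟩
      countLess (suc i) W₂                     ≡⟨ sym (+-identityʳ _) ⟩
      countLess (suc i) W₂ + 0                 ≡⟨ cong (countLess (suc i) W₂ +_) (sym countEq-1+i-R) ⟩
      rank W₂ R (suc i)                        ≡⟨ cong (rank W₂ R) (sym y≡1+i) ⟩
      rank W₂ R (val y)                        ∎

    suffix : stdAux W₁ (x ∷ R) post ≡ stdAux W₂ (y ∷ R) post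
    suffix = stdAux-cong (_≢ i) W₁ W₂ (x ∷ R) (y ∷ R) post post-no-i λ c c≢i → begin
      rank W₁ (x ∷ R) c              ≡⟨ rank-∷ W₁ R x c ⟩
      ind (val x ≡ᵇ c) + rank W₁ R c ≡⟨ cong (λ b → ind b + rank W₁ R c)
                                          (≢⇒≡ᵇ-false λ x≡c → c≢i (trans (sym x≡c) x≡i)) ⟩
      rank W₁ R c                    ≡⟨ rank-raise R c ⟩
      ind (val y ≡ᵇ c) + rank W₂ R c ≡⟨ sym (rank-∷ W₂ R y c) ⟩
      rank W₂ (y ∷ R) c              ∎

module _ {n : ℕ} where

  replaceLeftmost-split : ∀ a (y : Letter n) u v → replaceLeftmost a y u ≡ just v →
    ∃[ pre ] ∃[ x ] ∃[ post ]
      u ≡ pre ++ x ∷ post × v ≡ pre ++ y ∷ post × val x ≡ a × All (λ z → val z ≢ a) pre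
  replaceLeftmost-split a y (x ∷ u) v e with val x ≡ᵇ a in x≟a
  replaceLeftmost-split a y (x ∷ u) _ refl | true = [] , x , u , refl , refl , ≡ᵇ-true⇒≡ x≟a , []
  ... | false with replaceLeftmost a y u in e′
  replaceLeftmost-split a y (x ∷ u) _ refl | false | just w with replaceLeftmost-split a y u w e′
  ... | pre , x′ , post , refl , refl , x′≡a , pre-no-a =
    x ∷ pre , x′ , post , refl , refl , x′≡a , ≡ᵇ-false⇒≢ x≟a ∷ pre-no-a

  replaceRightmost-nothing : ∀ a (y : Letter n) u → replaceRightmost a y u ≡ nothing →
    All (λ z → val z ≢ a) u
  replaceRightmost-nothing a y []      _ = []
  replaceRightmost-nothing a y (x ∷ u) e with replaceRightmost a y u in e′
  ... | nothing with val x ≡ᵇ a in x≟a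
  ... | false = ≡ᵇ-false⇒≢ x≟a ∷ replaceRightmost-nothing a y u e′

  replaceRightmost-split : ∀ a (y : Letter n) u v → replaceRightmost a y u ≡ just v →
    ∃[ pre ] ∃[ x ] ∃[ post ]
      u ≡ pre ++ x ∷ post × v ≡ pre ++ y ∷ post × val x ≡ a × All (λ z → val z ≢ a) post
  replaceRightmost-split a y (x ∷ u) v e with replaceRightmost a y u in e′
  replaceRightmost-split a y (x ∷ u) _ refl | just w with replaceRightmost-split a y u w e′
  ... | pre , x′ , post , refl , refl , x′≡a , post-no-a = x ∷ pre , x′ , post , refl , refl , x′≡a , post-no-a
  replaceRightmost-split a y (x ∷ u) v e | nothing with val x ≡ᵇ a in x≟a
  replaceRightmost-split a y (x ∷ u) _ refl | nothing | true =
    [] , x , u , refl , refl , ≡ᵇ-true⇒≡ x≟a , replaceRightmost-nothing a y u e′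

  hasLetter-false : ∀ a (u : Word n) → hasLetter a u ≡ false → All (λ z → val z ≢ a) u
  hasLetter-false a []      _ = []
  hasLetter-false a (z ∷ u) e = ≡ᵇ-false⇒≢ (∨-conicalˡ _ _ e) ∷ hasLetter-false a u (∨-conicalʳ _ _ e)

  hasLetter-++ : ∀ a (p s : Word n) → hasLetter a s ≡ true → hasLetter a (p ++ s) ≡ true
  hasLetter-++ a []      s e = e
  hasLetter-++ a (z ∷ p) s e rewrite hasLetter-++ a p s e = ∨-zeroʳ _

  hasInv-++ʳ : ∀ i (p s : Word n) → hasInv i (p ++ s) ≡ false → hasInv i s ≡ false
  hasInv-++ʳ i []      s e = e
  hasInv-++ʳ i (z ∷ p) s e = hasInv-++ʳ i p s (∨-conicalʳ _ _ e)

  no-1+i-before-i : ∀ i (p s : Word n) → hasInv i (p ++ s) ≡ false → hasLetter i s ≡ true →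
    All (λ z → val z ≢ suc i) p
  no-1+i-before-i i []      s _ _ = []
  no-1+i-before-i i (z ∷ p) s e i∈s =
    ≡ᵇ-false⇒≢ z≢1+i ∷ no-1+i-before-i i p s (∨-conicalʳ _ _ e) i∈s
    where
    z≢1+i : (val z ≡ᵇ suc i) ≡ false
    z≢1+i = begin
      val z ≡ᵇ suc i                          ≡⟨ ∧-identityʳ _ ⟨
      (val z ≡ᵇ suc i) ∧ true                 ≡⟨ cong ((val z ≡ᵇ suc i) ∧_) (hasLetter-++ i p s i∈s) ⟨
      (val z ≡ᵇ suc i) ∧ hasLetter i (p ++ s) ≡⟨ ∨-conicalˡ _ _ e ⟩
      false                                   ∎

  no-i-after-1+i : ∀ i x (s : Word n) → val x ≡ suc i → hasInv i (x ∷ s) ≡ false →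
    All (λ z → val z ≢ i) s
  no-i-after-1+i i x s x≡1+i e = hasLetter-false i s
    (trans (cong (_∧ hasLetter i s) (sym (≡⇒≡ᵇ-true x≡1+i))) (∨-conicalˡ _ _ e))

val-letterBelow : ∀ {n} i (1≤i : 1 ≤ i) (i<n : i < n) → val (letterBelow i 1≤i i<n) ≡ i
val-letterBelow (suc j) (s≤s z≤n) i<n = cong suc (toℕ-fromℕ< _)

eOp-std : ∀ {n} i (1≤i : 1 ≤ i) (i<n : i < n) (u v : Word n) → eOp i 1≤i i<n u ≡ just v → std v ≡ std u
eOp-std i 1≤i i<n u v e with hasInv i u in no-inv
eOp-std i 1≤i i<n u v () | true
... | false with replaceLeftmost-split (suc i) (letterBelow i 1≤i i<n) u v e
... | pre , x , post , refl , refl , x≡1+i , pre-no-1+i =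
  RaiseLetter.std-raise i pre post (letterBelow i 1≤i i<n) x (val-letterBelow i 1≤i i<n) x≡1+i
    pre-no-1+i (no-i-after-1+i i x post x≡1+i (hasInv-++ʳ i pre (x ∷ post) no-inv))

fOp-std : ∀ {n} i (1≤i : 1 ≤ i) (i<n : i < n) (u v : Word n) → fOp i 1≤i i<n u ≡ just v → std v ≡ std u
fOp-std i 1≤i i<n u v e with hasInv i u in no-inv
fOp-std i 1≤i i<n u v () | true
... | false with replaceRightmost-split i (fromℕ< i<n) u v e
... | pre , x , post , refl , refl , x≡i , post-no-i =
  sym (RaiseLetter.std-raise i pre post x (fromℕ< i<n) x≡i (cong suc (toℕ-fromℕ< i<n))
    (no-1+i-before-i i pre (x ∷ post) no-inv (cong (_∨ hasLetter i post) (≡⇒≡ᵇ-true x≡i))) post-no-i)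

proposition6p1 : (n : ℕ) (u : Word n) (i : ℕ) (1≤i : 1 ≤ i) (i<n : i < n) →
    (∀ (v : Word n) → eOp i 1≤i i<n u ≡ just v → std v ≡ std u) ×
    (∀ (v : Word n) → fOp i 1≤i i<n u ≡ just v → std v ≡ std u)
proposition6p1 n u i 1≤i i<n = eOp-std i 1≤i i<n u , fOp-std i 1≤i i<n u
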